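{- Let $G$, $S$, $M$, $A,B,C,D$ be as in the context. Let $S_u$ be a solo $D$ pair and let $x,y\in V\setminus S$ with $\overline{u}x\in E(G)$ and $uy\in E(G)$. Suppose $w_1\in D\setminus S_u$ is a neighbor of $x$ and $w_2\in D\setminus S_u$ is a neighbor of $y$, with $w_1\neq w_2$ and $w_2\neq\overline{w_1}$ (i.e. $\{w_1,w_2\}$ is a constraint pair of $S_u$). Then there is a vertex $t\in V\setminus S$ such that $N_S(t)\subseteq\{u,\overline{u},\overline{w_1},\overline{w_2}\}$.
   Context: Let $G=(V,E)$ be a finite simple connected cubic graph. A paired dominating set (PDS) of $G$ is a set $S\subseteq V$ such that every vertex of $V\setminus S$ has a neighbor in $S$ and $G[S]$ has a perfect matching. Let $S$ be a PDS of minimum size and $M$ a perfect matching of $G[S]$. For $u\in S$ let $\overline{u}$ denote the vertex with $u\overline{u}\in M$, and call $S_u=\{u,\overline{u}\}$ a pair. For $x\in V\setminus S$ let $N_S(x)=N(x)\cap S$; $x$ is a private neighbor of $u\in S$ if $N_S(x)=\{u\}$. Define $A=\{v\in S: v$ and $\overline{v}$ together have at least two private neighbors$\}$, $B=\{v\in S: v$ has a private neighbor and $\overline{v}$ has none$\}$, $C=\{v\in S:\overline{v}\in B\}$, $D=\{v\in S:$ neither $v$ nor $\overline{v}$ has a private neighbor$\}$. Let $\lambda(S)$ be the number of edges of $G[S]$. The pair $(S,M)$ is chosen among all minimum PDSs and perfect matchings of their induced subgraphs so that (P1) $\lambda(S)$ is minimum, and (P2) subject to (P1), $|A\cup B|$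 is minimum. A $D$ pair is a pair with both vertices in $D$; a pair $S_u$ is solo if both $u$ and $\overline{u}$ have degree 1 in $G[S]$. -}

module Defs where

open import Data.Nat using (ℕ; _≤_; _<ᵇ_; _+_)
open import Data.Fin using (Fin; toℕ; _≟_)
open import Data.Bool using (Bool; true; false; if_then_else_; _∧_; _∨_; not)
open import Data.List using (List; map; allFin)
open import Data.Nat.ListAction using (sum)
open import Data.Bool.ListAction using (all)
open import Data.Product using (_×_; Σ; ∃; ∃-syntax)
open import Relation.Binary.PropositionalEquality using (_≡_)
open import Relation.Nullary.Decidable using (⌊_⌋)

record Graph (n : ℕ) : Set where
  field
    E      : Fin n → Fin n → Bool
    sym    : ∀ u v → E u v ≡ E v u
    irrefl : ∀ v → E v v ≡ false
open Graph public

VSet : ℕ → Set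
VSet n = Fin n → Bool

count : ∀ {n} → (Fin n → Bool) → ℕ
count {n} p = sum (map (λ i → if p i then 1 else 0) (allFin n))

degree : ∀ {n} → Graph n → Fin n → ℕ
degree G v = count (E G v)

Cubic : ∀ {n} → Graph n → Set
Cubic {n} G = ∀ (v : Fin n) → degree G v ≡ 3

data Reach {n} (G : Graph n) : Fin n → Fin n → Set where
  here : ∀ {v} → Reach G v v
  step : ∀ {u w v} → E G u w ≡ true → Reach G w v → Reach G u v

Connected : ∀ {n} → Graph n → Set
Connected {n} G = ∀ (u v : Fin n) → Reach G u v

-- A perfect matching of G[S], given by the partner map m (v ↦ v̄);
-- only its values on S matter.
IsPM : ∀ {n} → Graph n → VSet n → (Fin n → Fin n) → Set
IsPM {n} G S m = ∀ (v : Fin n) → S v ≡ true →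
  (S (m v) ≡ true) × (m (m v) ≡ v) × (E G v (m v) ≡ true)

Dominating : ∀ {n} → Graph n → VSet n → Set
Dominating {n} G S = ∀ (x : Fin n) → S x ≡ false →
  ∃[ w ] (S w ≡ true) × (E G x w ≡ true)

IsPDSM : ∀ {n} → Graph n → VSet n → (Fin n → Fin n) → Set
IsPDSM G S m = Dominating G S × IsPM G S m

IsPDS : ∀ {n} → Graph n → VSet n → Set
IsPDS {n} G S = Σ (Fin n → Fin n) (λ m → IsPDSM G S m)

MinPDS : ∀ {n} → Graph n → VSet n → Set
MinPDS G S = IsPDS G S × (∀ S' → IsPDS G S' → count S ≤ count S')

lam : ∀ {n} → Graph n → VSet n → ℕ
lam G S = sum (map (λ u → count (λ v →
            (toℕ u <ᵇ toℕ v) ∧ S u ∧ S v ∧ E G u v)) (allFin _))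

private? : ∀ {n} → Graph n → VSet n → Fin n → Fin n → Bool
private? G S u x = not (S x) ∧ E G x u ∧
  all (λ w → not (S w ∧ E G x w) ∨ ⌊ w ≟ u ⌋) (allFin _)

pcount : ∀ {n} → Graph n → VSet n → Fin n → ℕ
pcount G S u = count (private? G S u)

isZero : ℕ → Bool
isZero ℕ.zero = true
isZero (ℕ.suc _) = false

atLeast2 : ℕ → Bool
atLeast2 (ℕ.suc (ℕ.suc _)) = true
atLeast2 _ = false

inA : ∀ {n} → Graph n → VSet n → (Fin n → Fin n) → VSet n
inA G S m v = S v ∧ atLeast2 (pcount G S v + pcount G S (m v))

inB : ∀ {n} → Graph n → VSet n → (Fin n → Fin n) → VSet n
inB G S m v = S v ∧ not (isZero (pcount G S v)) ∧ isZero (pcount G S (m v))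

inC : ∀ {n} → Graph n → VSet n → (Fin n → Fin n) → VSet n
inC G S m v = S v ∧ inB G S m (m v)

inD : ∀ {n} → Graph n → VSet n → (Fin n → Fin n) → VSet n
inD G S m v = S v ∧ isZero (pcount G S v) ∧ isZero (pcount G S (m v))

sizeAB : ∀ {n} → Graph n → VSet n → (Fin n → Fin n) → ℕ
sizeAB G S m = count (λ v → inA G S m v ∨ inB G S m v)

-- (S, m) is chosen as in the paper: S a minimum PDS with matching m,
-- (P1) λ(S) minimum among minimum PDSs, (P2) subject to (P1), |A ∪ B| minimum.
Chosen : ∀ {n} → Graph n → VSet n → (Fin n → Fin n) → Set
Chosen G S m =
  IsPDSM G S m × MinPDS G S ×
  (∀ S' → MinPDS G S' → lam G S ≤ lam G S') ×
  (∀ S' m' → IsPDSM G S' m' → MinPDS G S' → lam G S' ≡ lam G S →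
     sizeAB G S m ≤ sizeAB G S' m')

degS : ∀ {n} → Graph n → VSet n → Fin n → ℕ
degS G S v = count (λ w → S w ∧ E G v w)

Solo : ∀ {n} → Graph n → VSet n → (Fin n → Fin n) → Fin n → Set
Solo G S m u = (degS G S u ≡ 1) × (degS G S (m u) ≡ 1)

module Submission where

-- Suppose no vertex t ∉ S had N_S(t) ⊆ {u, ū, w̄₁, w̄₂}.  Replace the pairs {u, ū}, {w₁, w̄₁},
-- {w₂, w̄₂} by the pairs {x, w₁}, {y, w₂}: the result S′ is paired dominating, since u, ū, w̄₁, w̄₂
-- are dominated by y, x, w₁, w₂ and every other vertex outside S keeps an S-neighbour in S′.
-- As |S′| = |S| − 2 this contradicts the minimality of S.  Cubicity gives x ≠ y (else x has
-- the four neighbours u, ū, w₁, w₂).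

open import Defs hiding (sym)
open import Data.Nat using (ℕ; suc; _≤_; _<_; _+_; z≤n; s≤s)
open import Data.Nat.Properties using (+-suc; n<1+n; n≤1+n; ≤⇒≯; module ≤-Reasoning)
open import Data.Fin using (Fin; zero; suc; _≟_)
open import Data.Fin.Properties using (any?; all?; ¬∀⟶∃¬)
open import Data.Bool using (Bool; true; false; if_then_else_)
import Data.Bool as Bool
open import Data.Bool.Properties using (¬-not; ∧-conicalˡ)
open import Data.List using (List; []; _∷_; length)
open import Data.List.Properties using (map-tabulate)
open import Data.List.Relation.Unary.All as All using (All; []; _∷_)
open import Data.List.Relation.Unary.AllPairs using ([]; _∷_)
open import Data.List.Relation.Unary.Unique.Propositional using (Unique)
open import Data.Nat.ListAction using (sum)
open import Data.Vec.Functional using (updateAt)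
open import Data.Vec.Functional.Properties using (updateAt-updates; updateAt-minimal)
open import Data.Empty using (⊥-elim)
open import Data.Product using (_×_; _,_; proj₁; proj₂; ∃; ∃-syntax)
open import Data.Sum using (_⊎_; inj₁; inj₂; [_,_]′)
open import Function using (_∘_; const; id)
open import Relation.Binary.PropositionalEquality
open import Relation.Nullary using (¬_; yes; no; does)
open import Relation.Nullary.Decidable using (dec-true; dec-false; _×-dec_; _→-dec_; _⊎-dec_)
open import Relation.Unary using (Decidable)

count-suc : ∀ {n} (p : Fin (suc n) → Bool) →
  count p ≡ (if p zero then 1 else 0) + count (p ∘ suc)
count-suc p =
  cong (f zero +_) (cong sum (trans (map-tabulate suc f) (sym (map-tabulate id (f ∘ suc)))))
  where
  f : Fin _ → ℕ
  f i = if p i then 1 else 0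

insert remove : ∀ {n} → Fin n → VSet n → VSet n
insert v T = updateAt T v (const true)
remove v T = updateAt T v (const false)

count-insert : ∀ {n} (T : VSet n) v → T v ≡ false → count (insert v T) ≡ suc (count T)
count-insert {suc n} T zero Tv rewrite count-suc T | count-suc (insert zero T) | Tv = refl
count-insert {suc n} T (suc v) Tv
  rewrite count-suc T | count-suc (insert (suc v) T) | count-insert (T ∘ suc) v Tv = +-suc _ _

count-remove : ∀ {n} (T : VSet n) v → T v ≡ true → count T ≡ suc (count (remove v T))
count-remove {suc n} T zero Tv rewrite count-suc T | count-suc (remove zero T) | Tv = refl
count-remove {suc n} T (suc v) Tv
  rewrite count-suc T | count-suc (remove (suc v) T) | count-remove (T ∘ suc) v Tv = +-suc _ _

Unique⇒length≤count : ∀ {n} (p : VSet n) {vs : List (Fin n)} →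
  Unique vs → All (λ v → p v ≡ true) vs → length vs ≤ count p
Unique⇒length≤count p [] [] = z≤n
Unique⇒length≤count p {v ∷ _} (v∉vs ∷ vs-unique) (pv ∷ pvs) rewrite count-remove p v pv =
  s≤s (Unique⇒length≤count (remove v p) vs-unique (All.zipWith kept (v∉vs , pvs)))
  where
  kept : ∀ {w} → v ≢ w × p w ≡ true → remove v p w ≡ true
  kept (v≢w , pw) = trans (updateAt-minimal _ v p (≢-sym v≢w)) pw

∈-∉-≢ : ∀ {n} {T : VSet n} {v w} → T v ≡ true → T w ≡ false → v ≢ w
∈-∉-≢ Tv Tw refl with trans (sym Tv) Tw
... | ()

insert-⊇ : ∀ {n} (T : VSet n) v {w} → T w ≡ true → insert v T w ≡ true
insert-⊇ T v {w} Tw with w ≟ v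
... | yes refl = updateAt-updates v T
... | no w≢v = trans (updateAt-minimal w v T w≢v) Tw

remove-⊆ : ∀ {n} (T : VSet n) v {w} → remove v T w ≡ true → T w ≡ true × w ≢ v
remove-⊆ T v {w} w∈ with w ≟ v
... | yes refl = ⊥-elim (∈-∉-≢ {T = remove v T} w∈ (updateAt-updates v T) refl)
... | no w≢v = trans (sym (updateAt-minimal w v T w≢v)) w∈ , w≢v

removePair : ∀ {n} → (Fin n → Fin n) → Fin n → VSet n → VSet n
removePair m v T = remove (m v) (remove v T)

addPair : ∀ {n} → Fin n → Fin n → VSet n → VSet n
addPair p q T = insert q (insert p T)

link : ∀ {n} → Fin n → Fin n → (Fin n → Fin n) → Fin n → Fin n
link p q m w = if does (w ≟ p) then q else if does (w ≟ q) then p else m w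

module _ {n} {p q : Fin n} (m : Fin n → Fin n) where

  link-fst : link p q m p ≡ q
  link-fst rewrite dec-true (p ≟ p) refl = refl

  link-snd : p ≢ q → link p q m q ≡ p
  link-snd p≢q rewrite dec-false (q ≟ p) (≢-sym p≢q) | dec-true (q ≟ q) refl = refl

  link-other : ∀ {w} → w ≢ p → w ≢ q → link p q m w ≡ m w
  link-other {w} w≢p w≢q rewrite dec-false (w ≟ p) w≢p | dec-false (w ≟ q) w≢q = refl

count-addPair : ∀ {n} (T : VSet n) {p q} → T p ≡ false → T q ≡ false → p ≢ q →
  count (addPair p q T) ≡ suc (suc (count T))
count-addPair T {p} {q} Tp Tq p≢q = begin
  count (insert q (insert p T)) ≡⟨ count-insert _ q (trans (updateAt-minimal q p T (≢-sym p≢q)) Tq) ⟩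
  suc (count (insert p T))      ≡⟨ cong suc (count-insert T p Tp) ⟩
  suc (suc (count T))           ∎
  where open ≡-Reasoning

addPair-⊇ : ∀ {n} (T : VSet n) {p q w} → T w ≡ true → addPair p q T w ≡ true
addPair-⊇ T {p} {q} Tw = insert-⊇ _ q (insert-⊇ T p Tw)

addPair-fst : ∀ {n} (T : VSet n) {p q} → p ≢ q → addPair p q T p ≡ true
addPair-fst T {p} {q} p≢q = trans (updateAt-minimal p q _ p≢q) (updateAt-updates p T)

addPair-snd : ∀ {n} (T : VSet n) {p q} → addPair p q T q ≡ true
addPair-snd T {p} {q} = updateAt-updates q (insert p T)

IsPM-addPair : ∀ {n} {G : Graph n} {T m p q} → IsPM G T m →
  T p ≡ false → T q ≡ false → p ≢ q → E G p q ≡ true → IsPM G (addPair p q T) (link p q m)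
IsPM-addPair {G = G} {T} {m} {p} {q} pm Tp Tq p≢q Epq w w∈ with w ≟ p | w ≟ q
... | yes refl | _ rewrite link-fst {p = p} {q} m | link-snd {p = p} {q} m p≢q =
  addPair-snd T , refl , Epq
... | no _ | yes refl rewrite link-snd {p = p} {q} m p≢q | link-fst {p = p} {q} m =
  addPair-fst T p≢q , refl , trans (Graph.sym G q p) Epq
... | no w≢p | no w≢q
  with pm w (trans (sym (trans (updateAt-minimal w q _ w≢q) (updateAt-minimal w p T w≢p))) w∈)
... | Tmw , mmw , Ewmw
  rewrite link-other {p = p} {q} m w≢p w≢q
        | link-other {p = p} {q} m (∈-∉-≢ {T = T} Tmw Tp) (∈-∉-≢ {T = T} Tmw Tq) | mmw =
  addPair-⊇ T Tmw , refl , Ewmw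

module PerfectMatching {n} (G : Graph n) {T : VSet n} {m : Fin n → Fin n} (pm : IsPM G T m) where

  partner-∈ : ∀ {v} → T v ≡ true → T (m v) ≡ true
  partner-∈ Tv = proj₁ (pm _ Tv)

  partner-involutive : ∀ {v} → T v ≡ true → m (m v) ≡ v
  partner-involutive Tv = proj₁ (proj₂ (pm _ Tv))

  partner-adjacent : ∀ {v} → T v ≡ true → E G v (m v) ≡ true
  partner-adjacent Tv = proj₂ (proj₂ (pm _ Tv))

  partner-≢ : ∀ {v} → T v ≡ true → m v ≢ v
  partner-≢ {v} Tv = ∈-∉-≢ {T = E G v} (partner-adjacent Tv) (Graph.irrefl G v)

  partner-injective : ∀ {v w} → T v ≡ true → T w ≡ true → m v ≡ m w → v ≡ w
  partner-injective Tv Tw mv≡mw =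
    trans (sym (partner-involutive Tv)) (trans (cong m mv≡mw) (partner-involutive Tw))

  removePair-⊆ : ∀ {v w} → removePair m v T w ≡ true → T w ≡ true × w ≢ v × w ≢ m v
  removePair-⊆ {v} w∈ with remove-⊆ _ (m v) w∈
  ... | w∈′ , w≢mv with remove-⊆ T v w∈′
  ...   | Tw , w≢v = Tw , w≢v , w≢mv

  removePair-keeps : ∀ {v w} → T w ≡ true → w ≢ v → w ≢ m v → removePair m v T w ≡ true
  removePair-keeps {v} {w} Tw w≢v w≢mv =
    trans (updateAt-minimal w (m v) _ w≢mv) (trans (updateAt-minimal w v T w≢v) Tw)

  count-removePair : ∀ {v} → T v ≡ true → count T ≡ suc (suc (count (removePair m v T)))
  count-removePair {v} Tv = begin
    count T                 ≡⟨ count-remove T v Tv ⟩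
    suc (count (remove v T)) ≡⟨ cong suc (count-remove _ (m v) mv∈) ⟩
    suc (suc (count (removePair m v T))) ∎
    where
    open ≡-Reasoning
    mv∈ : remove v T (m v) ≡ true
    mv∈ = trans (updateAt-minimal (m v) v T (partner-≢ Tv)) (partner-∈ Tv)

  IsPM-removePair : ∀ {v} → T v ≡ true → IsPM G (removePair m v T) m
  IsPM-removePair {v} Tv w w∈ with removePair-⊆ w∈
  ... | Tw , w≢v , w≢mv =
    removePair-keeps (partner-∈ Tw) mw≢v mw≢mv , partner-involutive Tw , partner-adjacent Tw
    where
    mw≢v : m w ≢ v
    mw≢v mw≡v = w≢mv (trans (sym (partner-involutive Tw)) (cong m mw≡v))
    mw≢mv : m w ≢ m v
    mw≢mv = w≢v ∘ partner-injective Tw Tv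

Confined : ∀ {n} → Graph n → VSet n → (Fin n → Set) → Fin n → Set
Confined G S P t = S t ≡ false × (∀ s → S s ≡ true → E G t s ≡ true → P s)

confined? : ∀ {n} (G : Graph n) (S : VSet n) {P : Fin n → Set} → Decidable P →
  Decidable (Confined G S P)
confined? G S P? t =
  (S t Bool.≟ false) ×-dec all? (λ s → (S s Bool.≟ true) →-dec (E G t s Bool.≟ true) →-dec P? s)

¬-implication : ∀ {a b : Bool} {Q : Set} → ¬ (a ≡ true → b ≡ true → Q) → a ≡ true × b ≡ true × ¬ Q
¬-implication {false} ¬a→b→Q = ⊥-elim (¬a→b→Q λ ())
¬-implication {true} {false} ¬a→b→Q = ⊥-elim (¬a→b→Q λ _ ())
¬-implication {true} {true} ¬a→b→Q = refl , refl , λ q → ¬a→b→Q λ _ _ → q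

Escaping : ∀ {n} → Graph n → VSet n → (Fin n → Set) → Set
Escaping G S P = ∀ v → S v ≡ false → ∃[ s ] S s ≡ true × E G v s ≡ true × ¬ P s

confined-or-escaping : ∀ {n} (G : Graph n) (S : VSet n) {P : Fin n → Set} → Decidable P →
  ∃ (Confined G S P) ⊎ Escaping G S P
confined-or-escaping {n} G S {P} P? with any? (confined? G S P?)
... | yes confined = inj₁ confined
... | no ¬confined = inj₂ escaping
  where
  escaping : Escaping G S P
  escaping v Sv with ¬∀⟶∃¬ n _ (λ s → (S s Bool.≟ true) →-dec (E G v s Bool.≟ true) →-dec P? s)
                              (λ all → ¬confined (v , Sv , all))
  ... | s , ¬inP = s , ¬-implication ¬inP

MinPDS⇒no-smaller : ∀ {n} {G : Graph n} {S} → MinPDS G S →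
  ¬ (∃[ S′ ] IsPDS G S′ × count S′ < count S)
MinPDS⇒no-smaller (_ , minimal) (S′ , S′-PDS , smaller) = ≤⇒≯ (minimal S′ S′-PDS) smaller

cubic-no-four-neighbours : ∀ {n} {G : Graph n} → Cubic G → ∀ v {a b c d} →
  Unique (a ∷ b ∷ c ∷ d ∷ []) → ¬ All (λ w → E G v w ≡ true) (a ∷ b ∷ c ∷ d ∷ [])
cubic-no-four-neighbours {G = G} cubic v distinct adjacent
  with subst (4 ≤_) (cubic v) (Unique⇒length≤count (E G v) distinct adjacent)
... | s≤s (s≤s (s≤s ()))

module Exchange {n} {G : Graph n} {S : VSet n} {m : Fin n → Fin n} (pm : IsPM G S m)
  {u w₁ w₂ x y : Fin n} (Su : S u ≡ true) (Sw₁ : S w₁ ≡ true) (Sw₂ : S w₂ ≡ true)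
  (w₁≢u : w₁ ≢ u) (w₁≢mu : w₁ ≢ m u) (w₂≢u : w₂ ≢ u) (w₂≢mu : w₂ ≢ m u)
  (w₁≢w₂ : w₁ ≢ w₂) (w₂≢mw₁ : w₂ ≢ m w₁)
  (Sx : S x ≡ false) (Sy : S y ≡ false) (x≢y : x ≢ y)
  (Emux : E G (m u) x ≡ true) (Euy : E G u y ≡ true)
  (Exw₁ : E G x w₁ ≡ true) (Eyw₂ : E G y w₂ ≡ true) where

  Dropped : Fin n → Set
  Dropped s = (s ≡ u) ⊎ (s ≡ m u) ⊎ (s ≡ m w₁) ⊎ (s ≡ m w₂)

  dropped? : Decidable Dropped
  dropped? s = (s ≟ u) ⊎-dec (s ≟ m u) ⊎-dec (s ≟ m w₁) ⊎-dec (s ≟ m w₂)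

  S₁ S₂ T₀ T₁ S′ : VSet n
  S₁ = removePair m u S
  S₂ = removePair m w₁ S₁
  T₀ = removePair m w₂ S₂
  T₁ = addPair y w₂ T₀
  S′ = addPair x w₁ T₁

  m′ : Fin n → Fin n
  m′ = link x w₁ (link y w₂ m)

  open PerfectMatching G pm

  pm₁ : IsPM G S₁ m
  pm₁ = IsPM-removePair Su

  module M₁ = PerfectMatching G pm₁

  w₁∈S₁ : S₁ w₁ ≡ true
  w₁∈S₁ = removePair-keeps Sw₁ w₁≢u w₁≢mu

  pm₂ : IsPM G S₂ m
  pm₂ = M₁.IsPM-removePair w₁∈S₁

  module M₂ = PerfectMatching G pm₂

  w₂∈S₂ : S₂ w₂ ≡ true
  w₂∈S₂ = M₁.removePair-keeps (removePair-keeps Sw₂ w₂≢u w₂≢mu) (≢-sym w₁≢w₂) w₂≢mw₁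

  pm₀ : IsPM G T₀ m
  pm₀ = M₂.IsPM-removePair w₂∈S₂

  T₀-⊆ : ∀ {s} → T₀ s ≡ true → S s ≡ true × s ≢ w₁ × s ≢ w₂
  T₀-⊆ T₀s with M₂.removePair-⊆ T₀s
  ... | S₂s , s≢w₂ , _ with M₁.removePair-⊆ S₂s
  ...   | S₁s , s≢w₁ , _ = proj₁ (removePair-⊆ S₁s) , s≢w₁ , s≢w₂

  T₀-keeps : ∀ {s} → S s ≡ true → s ≢ u → s ≢ m u → s ≢ w₁ → s ≢ m w₁ → s ≢ w₂ → s ≢ m w₂ →
    T₀ s ≡ true
  T₀-keeps Ss s≢u s≢mu s≢w₁ s≢mw₁ s≢w₂ s≢mw₂ =
    M₂.removePair-keeps (M₁.removePair-keeps (removePair-keeps Ss s≢u s≢mu) s≢w₁ s≢mw₁) s≢w₂ s≢mw₂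

  outside≢inside : ∀ {v w} → S v ≡ false → S w ≡ true → v ≢ w
  outside≢inside Sv Sw v≡w = ∈-∉-≢ {T = S} Sw Sv (sym v≡w)

  x∉T₀ : T₀ x ≡ false
  x∉T₀ = ¬-not λ T₀x → ∈-∉-≢ {T = S} (proj₁ (T₀-⊆ T₀x)) Sx refl

  y∉T₀ : T₀ y ≡ false
  y∉T₀ = ¬-not λ T₀y → ∈-∉-≢ {T = S} (proj₁ (T₀-⊆ T₀y)) Sy refl

  w₁∉T₀ : T₀ w₁ ≡ false
  w₁∉T₀ = ¬-not λ T₀w₁ → proj₁ (proj₂ (T₀-⊆ T₀w₁)) refl

  w₂∉T₀ : T₀ w₂ ≡ false
  w₂∉T₀ = ¬-not λ T₀w₂ → proj₂ (proj₂ (T₀-⊆ T₀w₂)) refl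

  x∉T₁ : T₁ x ≡ false
  x∉T₁ = trans (updateAt-minimal x w₂ _ (outside≢inside Sx Sw₂))
               (trans (updateAt-minimal x y T₀ x≢y) x∉T₀)

  w₁∉T₁ : T₁ w₁ ≡ false
  w₁∉T₁ = trans (updateAt-minimal w₁ w₂ _ w₁≢w₂)
                (trans (updateAt-minimal w₁ y T₀ (≢-sym (outside≢inside Sy Sw₁))) w₁∉T₀)

  pm′ : IsPM G S′ m′
  pm′ = IsPM-addPair {G = G} pm₁′ x∉T₁ w₁∉T₁ (outside≢inside Sx Sw₁) Exw₁
    where
    pm₁′ : IsPM G T₁ (link y w₂ m)
    pm₁′ = IsPM-addPair {G = G} pm₀ y∉T₀ w₂∉T₀ (outside≢inside Sy Sw₂) Eyw₂

  count-S′<count-S : count S′ < count S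
  count-S′<count-S = begin-strict
    count S′                      ≡⟨ count-addPair T₁ x∉T₁ w₁∉T₁ (outside≢inside Sx Sw₁) ⟩
    2 + count T₁                  ≡⟨ cong (2 +_) (count-addPair T₀ y∉T₀ w₂∉T₀ (outside≢inside Sy Sw₂)) ⟩
    4 + count T₀                  <⟨ n<1+n _ ⟩
    5 + count T₀                  ≤⟨ n≤1+n _ ⟩
    6 + count T₀                  ≡⟨ cong (4 +_) (M₂.count-removePair w₂∈S₂) ⟨
    4 + count S₂                  ≡⟨ cong (2 +_) (M₁.count-removePair w₁∈S₁) ⟨
    2 + count S₁                  ≡⟨ count-removePair Su ⟨
    count S                       ∎
    where open ≤-Reasoning

  S′-⊇ : ∀ {s} → S s ≡ true → ¬ Dropped s → S′ s ≡ true
  S′-⊇ {s} Ss ¬dropped with s ≟ w₁ | s ≟ w₂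
  ... | yes refl | _ = addPair-snd T₁
  ... | no _ | yes refl = addPair-⊇ T₁ (addPair-snd T₀)
  ... | no s≢w₁ | no s≢w₂ = addPair-⊇ T₁ (addPair-⊇ T₀ (T₀-keeps Ss
        (¬dropped ∘ inj₁) (¬dropped ∘ inj₂ ∘ inj₁) s≢w₁ (¬dropped ∘ inj₂ ∘ inj₂ ∘ inj₁)
        s≢w₂ (¬dropped ∘ inj₂ ∘ inj₂ ∘ inj₂)))

  dominating : Escaping G S Dropped → Dominating G S′
  dominating escaping v S′v with dropped? v
  ... | yes (inj₁ refl) = y , addPair-⊇ T₁ (addPair-fst T₀ (outside≢inside Sy Sw₂)) , Euy
  ... | yes (inj₂ (inj₁ refl)) = x , addPair-fst T₁ (outside≢inside Sx Sw₁) , Emux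
  ... | yes (inj₂ (inj₂ (inj₁ refl))) =
    w₁ , addPair-snd T₁ , trans (Graph.sym G _ w₁) (partner-adjacent Sw₁)
  ... | yes (inj₂ (inj₂ (inj₂ refl))) =
    w₂ , addPair-⊇ T₁ (addPair-snd T₀) , trans (Graph.sym G _ w₂) (partner-adjacent Sw₂)
  ... | no ¬dropped with escaping v (¬-not λ Sv → ∈-∉-≢ {T = S′} (S′-⊇ Sv ¬dropped) S′v refl)
  ...   | s , Ss , Evs , ¬dropped-s = s , S′-⊇ Ss ¬dropped-s , Evs

  smaller-PDS : Escaping G S Dropped → ∃[ S″ ] IsPDS G S″ × count S″ < count S
  smaller-PDS escaping = S′ , (m′ , dominating escaping , pm′) , count-S′<count-S

lemma10 : ∀ {n} (G : Graph n) → Cubic G → Connected G →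
    (S : VSet n) (m : Fin n → Fin n) → Chosen G S m →
    (u : Fin n) → inD G S m u ≡ true → inD G S m (m u) ≡ true → Solo G S m u →
    (x y : Fin n) → S x ≡ false → S y ≡ false →
    E G (m u) x ≡ true → E G u y ≡ true →
    (w₁ w₂ : Fin n) → inD G S m w₁ ≡ true → inD G S m w₂ ≡ true →
    ¬ (w₁ ≡ u) → ¬ (w₁ ≡ m u) → ¬ (w₂ ≡ u) → ¬ (w₂ ≡ m u) →
    E G x w₁ ≡ true → E G y w₂ ≡ true →
    ¬ (w₁ ≡ w₂) → ¬ (w₂ ≡ m w₁) →
    ∃[ t ] (S t ≡ false) × (∀ s → S s ≡ true → E G t s ≡ true →
    (s ≡ u) ⊎ (s ≡ m u) ⊎ (s ≡ m w₁) ⊎ (s ≡ m w₂))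
lemma10 G cubic _ S m ((_ , pm) , minPDS , _) u Du _ _ x y Sx Sy Emux Euy w₁ w₂ Dw₁ Dw₂
        w₁≢u w₁≢mu w₂≢u w₂≢mu Exw₁ Eyw₂ w₁≢w₂ w₂≢mw₁ =
  [ id , ⊥-elim ∘ MinPDS⇒no-smaller {G = G} minPDS ∘ smaller-PDS ]′
    (confined-or-escaping G S dropped?)
  where
  open PerfectMatching G pm using (partner-≢)

  Su : S u ≡ true
  Su = ∧-conicalˡ (S u) _ Du
  Sw₁ : S w₁ ≡ true
  Sw₁ = ∧-conicalˡ (S w₁) _ Dw₁
  Sw₂ : S w₂ ≡ true
  Sw₂ = ∧-conicalˡ (S w₂) _ Dw₂

  x≢y : x ≢ y
  x≢y refl = cubic-no-four-neighbours {G = G} cubic x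
    ((≢-sym (partner-≢ Su) ∷ ≢-sym w₁≢u ∷ ≢-sym w₂≢u ∷ [])
      ∷ (≢-sym w₁≢mu ∷ ≢-sym w₂≢mu ∷ []) ∷ (w₁≢w₂ ∷ []) ∷ [] ∷ [])
    (trans (Graph.sym G x u) Euy ∷ trans (Graph.sym G x (m u)) Emux ∷ Exw₁ ∷ Eyw₂ ∷ [])

  open Exchange {G = G} pm Su Sw₁ Sw₂ w₁≢u w₁≢mu w₂≢u w₂≢mu w₁≢w₂ w₂≢mw₁
                Sx Sy x≢y Emux Euy Exw₁ Eyw₂
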